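{- Let $C\subseteq\mathbb{R}^3$ be the cone spanned by $P_0=(-1,1,2)$, $P_1=(1,-1,1)$, $P_2=(0,1,0)$ and $P_3=(1,0,0)$. There is no finite subset $B\subseteq C\cap\mathbb{Z}^3$ which generates the monoid $C\cap\mathbb{Z}^3$ and is supernormal.
   Context: For a finite set $D$, $\mathrm{cone}(D)$ is the set of non-negative real combinations of $D$. A finite configuration $B\subseteq\mathbb{Z}^m$ is supernormal if for every subset $B'\subseteq B$, every point of $\mathrm{cone}(B')\cap\mathbb{Z}^m$ is a non-negative integer combination of the elements of $B\cap\mathrm{cone}(B')$. -}

module Defs where

open import Data.Integer using (ℤ; +_; -[1+_]) renaming (_+_ to _+ℤ_)
open import Data.Rational using (ℚ; 0ℚ; _≤_; _/_) renaming (_+_ to _+ℚ_; _*_ to _*ℚ_)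
open import Data.Product using (_×_; _,_)
open import Data.List using (List; []; _∷_)
open import Data.List.Membership.Propositional using (_∈_)
open import Data.List.Relation.Binary.Subset.Propositional using (_⊆_)
open import Level using (Level)

Point : Set
Point = ℤ × ℤ × ℤ

QPoint : Set
QPoint = ℚ × ℚ × ℚ

_+ᵖ_ : Point → Point → Point
(a , b , c) +ᵖ (x , y , z) = (a +ℤ x , b +ℤ y , c +ℤ z)

0ᵖ : Point
0ᵖ = (+ 0 , + 0 , + 0)

_+ᵠ_ : QPoint → QPoint → QPoint
(a , b , c) +ᵠ (x , y , z) = (a +ℚ x , b +ℚ y , c +ℚ z)

0ᵠ : QPoint
0ᵠ = (0ℚ , 0ℚ , 0ℚ)

ℤ→ℚ : ℤ → ℚ
ℤ→ℚ n = n / 1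

toQ : Point → QPoint
toQ (a , b , c) = (ℤ→ℚ a , ℤ→ℚ b , ℤ→ℚ c)

_·ᵠ_ : ℚ → Point → QPoint
t ·ᵠ (a , b , c) = (t *ℚ ℤ→ℚ a , t *ℚ ℤ→ℚ b , t *ℚ ℤ→ℚ c)

data ConeComb (P : Point → Set) : QPoint → Set where
  cone-zero : ConeComb P 0ᵠ
  cone-add  : ∀ {b q} (t : ℚ) → P b → 0ℚ ≤ t → ConeComb P q →
              ConeComb P ((t ·ᵠ b) +ᵠ q)

InCone : List Point → Point → Set
InCone D v = ConeComb (_∈ D) (toQ v)

data NComb (P : Point → Set) : Point → Set where
  ncomb-zero : NComb P 0ᵖ
  ncomb-add  : ∀ {b v} → P b → NComb P v → NComb P (b +ᵖ v)

Supernormal : List Point → Set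
Supernormal B =
  ∀ (B' : List Point) → B' ⊆ B →
  ∀ (v : Point) → InCone B' v →
  NComb (λ b → (b ∈ B) × InCone B' b) v

P₀ P₁ P₂ P₃ : Point
P₀ = (-[1+ 0 ] , + 1 , + 2)
P₁ = (+ 1 , -[1+ 0 ] , + 1)
P₂ = (+ 0 , + 1 , + 0)
P₃ = (+ 1 , + 0 , + 0)

InC : Point → Set
InC = InCone (P₀ ∷ P₁ ∷ P₂ ∷ P₃ ∷ [])

module Submission where

-- A point v that is irreducible in a monoid M of lattice points, and is a sum of generators lying
-- in M, is itself one of the generators. Irreducibility is certified by a simplicial cone
-- cone(d₁, d₂, d₃) of determinant Δ: if the face {d₁, d₂} extends to a lattice basis, v lies at
-- height det(d₁, d₂, v) = 1 above that face, and its other two Cramer coordinates det(d₂, d₃, v)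
-- and det(d₃, d₁, v) lie in [0, Δ), then v is irreducible in cone(d₁, d₂, d₃) ∩ ℤ³. Unimodular
-- cones containing C show that a generating set B contains the rays P₀, …, P₃. If B is moreover
-- supernormal, the simplex (P₀, (1,0,k), P₂), of determinant k + 2, puts (0,1,k+1) into B, and
-- the simplex ((0,1,k+1), P₁, P₃), of the same determinant, puts (1,0,k+1) into B; so the finite
-- list B would contain every (1,0,k).

open import Level using (0ℓ)
open import Algebra.Bundles.Raw using (RawRing)
open import Data.Product using (_×_; _,_; proj₁; proj₂)

module Coordinates (R : RawRing 0ℓ 0ℓ) where
  open RawRing R

  Triple : Set
  Triple = Carrier × Carrier × Carrier

  infixl 6 _⊕_
  infixr 7 _⊛_
  infix  8 _∙_
  infixl 9 _⨯_
  infix  5 _↑_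

  _∙_ : Triple → Triple → Carrier
  (a , b , c) ∙ (x , y , z) = a * x + b * y + c * z

  _⊕_ : Triple → Triple → Triple
  (a , b , c) ⊕ (x , y , z) = (a + x , b + y , c + z)

  _⊛_ : Carrier → Triple → Triple
  t ⊛ (x , y , z) = (t * x , t * y , t * z)

  _⨯_ : Triple → Triple → Triple
  (a , b , c) ⨯ (x , y , z) = (b * z + - (c * y) , c * x + - (a * z) , a * y + - (b * x))

  det : Triple → Triple → Triple → Carrier
  det a b c = a ⨯ b ∙ c

  _↑_ : Triple → Carrier → Triple
  (x , y , z) ↑ n = (x , y , z + n)

open import Data.Nat as ℕ using (ℕ; zero; suc; z≤n; s≤s)
import Data.Nat.Properties as ℕP
import Data.Nat.Coprimality as Coprimality
open import Data.Integer as ℤ using (ℤ; +_; +0; +[1+_]; -[1+_]; 0ℤ; 1ℤ; _+_; _*_; _≤_; _<_; +≤+; +<+)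
import Data.Integer.Properties as ℤP
open import Data.Integer.Solver using (module +-*-Solver)
open import Data.Rational as ℚ using (ℚ; mkℚ; 0ℚ; 1ℚ; 1/_)
import Data.Rational.Properties as ℚP
import Data.Rational.Solver as ℚSolver
open import Data.Sum using (_⊎_; inj₁; inj₂)
open import Data.List using (List; []; _∷_)
open import Data.List.Membership.Propositional using (_∈_)
open import Data.List.Membership.Propositional.Properties using (finite)
open import Data.List.Relation.Unary.All as All using (All; []; _∷_)
open import Data.List.Relation.Unary.Any using (here; there)
open import Function.Bundles using (_↣_; mk↣)
open import Relation.Binary.PropositionalEquality
open import Relation.Nullary using (¬_; contradiction)
open import Relation.Nullary.Decidable using (True; toWitness)
open import Relation.Unary using (Decidable)
open import Defs

open Coordinates ℤ.+-*-rawRing using (_∙_; _⨯_; det; _⊛_; _↑_)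

polynomials : ℕ → RawRing 0ℓ 0ℓ
polynomials n = record
  { Carrier = Polynomial n ; _≈_ = _≡_
  ; _+_ = _:+_ ; _*_ = _:*_ ; -_ = :-_ ; 0# = con 0ℤ ; 1# = con 1ℤ }
  where open +-*-Solver using (Polynomial; _:+_; _:*_; :-_; con)

-- Syn applies the operations of Coordinates to the ring solver's syntax; since the semantics of
-- that syntax unfolds definitionally to the ℤ operations, identities between dot products, cross
-- products and determinants can be stated in folded form and proved by `solve n (… := …) refl`.
module Syn {n : ℕ} = Coordinates (polynomials n)

⌜_⌝ : ∀ {n} → Point → Syn.Triple {n}
⌜ x , y , z ⌝ = +-*-Solver.con x , +-*-Solver.con y , +-*-Solver.con z

-- Linear algebra in ℤ³

+ᵖ-comm : ∀ p q → p +ᵖ q ≡ q +ᵖ p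
+ᵖ-comm (a , b , c) (x , y , z) = cong₂ _,_ (ℤP.+-comm a x) (cong₂ _,_ (ℤP.+-comm b y) (ℤP.+-comm c z))

+ᵖ-identityˡ : ∀ p → 0ᵖ +ᵖ p ≡ p
+ᵖ-identityˡ (x , y , z) = cong₂ _,_ (ℤP.+-identityˡ x) (cong₂ _,_ (ℤP.+-identityˡ y) (ℤP.+-identityˡ z))

+ᵖ-identityʳ : ∀ p → p +ᵖ 0ᵖ ≡ p
+ᵖ-identityʳ (x , y , z) = cong₂ _,_ (ℤP.+-identityʳ x) (cong₂ _,_ (ℤP.+-identityʳ y) (ℤP.+-identityʳ z))

⊛-identityˡ : ∀ p → 1ℤ ⊛ p ≡ p
⊛-identityˡ (x , y , z) = cong₂ _,_ (ℤP.*-identityˡ x) (cong₂ _,_ (ℤP.*-identityˡ y) (ℤP.*-identityˡ z))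

module _ where
  open +-*-Solver using (solve; _:=_; _:+_; _:*_; con)

  ∙-zeroʳ : ∀ f → f ∙ 0ᵖ ≡ 0ℤ
  ∙-zeroʳ (a , b , c) = solve 3 (λ a b c → (a , b , c) Syn.∙ ⌜ 0ᵖ ⌝ := con 0ℤ) refl a b c

  ∙-+ᵖ : ∀ f p q → f ∙ (p +ᵖ q) ≡ f ∙ p + f ∙ q
  ∙-+ᵖ (a , b , c) (x , y , z) (x′ , y′ , z′) = solve 9
    (λ a b c x y z x′ y′ z′ → let f = (a , b , c); p = (x , y , z); q = (x′ , y′ , z′) in
       f Syn.∙ (p Syn.⊕ q) := f Syn.∙ p :+ f Syn.∙ q)
    refl a b c x y z x′ y′ z′

  ∙-⊛ : ∀ f t p → f ∙ (t ⊛ p) ≡ t * f ∙ p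
  ∙-⊛ (a , b , c) t (x , y , z) = solve 7
    (λ a b c t x y z → (a , b , c) Syn.∙ (t Syn.⊛ (x , y , z)) := t :* ((a , b , c) Syn.∙ (x , y , z)))
    refl a b c t x y z

  ∙-combination : ∀ f α p β q → f ∙ ((α ⊛ p) +ᵖ (β ⊛ q)) ≡ α * f ∙ p + β * f ∙ q
  ∙-combination f α p β q = trans (∙-+ᵖ f (α ⊛ p) (β ⊛ q)) (cong₂ _+_ (∙-⊛ f α p) (∙-⊛ f β q))

  det-cycle : ∀ a b c → det a b c ≡ det b c a
  det-cycle (a₁ , a₂ , a₃) (b₁ , b₂ , b₃) (c₁ , c₂ , c₃) = solve 9
    (λ a₁ a₂ a₃ b₁ b₂ b₃ c₁ c₂ c₃ → let a = (a₁ , a₂ , a₃); b = (b₁ , b₂ , b₃); c = (c₁ , c₂ , c₃) in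
       Syn.det a b c := Syn.det b c a)
    refl a₁ a₂ a₃ b₁ b₂ b₃ c₁ c₂ c₃

  det-repeat₁₃ : ∀ a b → det a b a ≡ 0ℤ
  det-repeat₁₃ (a₁ , a₂ , a₃) (b₁ , b₂ , b₃) = solve 6
    (λ a₁ a₂ a₃ b₁ b₂ b₃ → let a = (a₁ , a₂ , a₃); b = (b₁ , b₂ , b₃) in Syn.det a b a := con 0ℤ)
    refl a₁ a₂ a₃ b₁ b₂ b₃

  det-repeat₂₃ : ∀ a b → det a b b ≡ 0ℤ
  det-repeat₂₃ (a₁ , a₂ , a₃) (b₁ , b₂ , b₃) = solve 6
    (λ a₁ a₂ a₃ b₁ b₂ b₃ → let a = (a₁ , a₂ , a₃); b = (b₁ , b₂ , b₃) in Syn.det a b b := con 0ℤ)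
    refl a₁ a₂ a₃ b₁ b₂ b₃

  cramer : ∀ a b c s → det a b c ⊛ s ≡ ((det b c s ⊛ a) +ᵖ (det c a s ⊛ b)) +ᵖ (det a b s ⊛ c)
  cramer a@(a₁ , a₂ , a₃) b@(b₁ , b₂ , b₃) c@(c₁ , c₂ , c₃) s@(s₁ , s₂ , s₃) =
    cong₂ _,_ first (cong₂ _,_ second third)
    where
    rhs : Point
    rhs = ((det b c s ⊛ a) +ᵖ (det c a s ⊛ b)) +ᵖ (det a b s ⊛ c)
    first : proj₁ (det a b c ⊛ s) ≡ proj₁ rhs
    first = solve 12
      (λ a₁ a₂ a₃ b₁ b₂ b₃ c₁ c₂ c₃ s₁ s₂ s₃ →
         let a = (a₁ , a₂ , a₃); b = (b₁ , b₂ , b₃); c = (c₁ , c₂ , c₃); s = (s₁ , s₂ , s₃) in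
         proj₁ (Syn.det a b c Syn.⊛ s) :=
         proj₁ (Syn.det b c s Syn.⊛ a Syn.⊕ Syn.det c a s Syn.⊛ b Syn.⊕ Syn.det a b s Syn.⊛ c))
      refl a₁ a₂ a₃ b₁ b₂ b₃ c₁ c₂ c₃ s₁ s₂ s₃
    second : proj₁ (proj₂ (det a b c ⊛ s)) ≡ proj₁ (proj₂ rhs)
    second = solve 12
      (λ a₁ a₂ a₃ b₁ b₂ b₃ c₁ c₂ c₃ s₁ s₂ s₃ →
         let a = (a₁ , a₂ , a₃); b = (b₁ , b₂ , b₃); c = (c₁ , c₂ , c₃); s = (s₁ , s₂ , s₃) in
         proj₁ (proj₂ (Syn.det a b c Syn.⊛ s)) :=
         proj₁ (proj₂ (Syn.det b c s Syn.⊛ a Syn.⊕ Syn.det c a s Syn.⊛ b Syn.⊕ Syn.det a b s Syn.⊛ c)))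
      refl a₁ a₂ a₃ b₁ b₂ b₃ c₁ c₂ c₃ s₁ s₂ s₃
    third : proj₂ (proj₂ (det a b c ⊛ s)) ≡ proj₂ (proj₂ rhs)
    third = solve 12
      (λ a₁ a₂ a₃ b₁ b₂ b₃ c₁ c₂ c₃ s₁ s₂ s₃ →
         let a = (a₁ , a₂ , a₃); b = (b₁ , b₂ , b₃); c = (c₁ , c₂ , c₃); s = (s₁ , s₂ , s₃) in
         proj₂ (proj₂ (Syn.det a b c Syn.⊛ s)) :=
         proj₂ (proj₂ (Syn.det b c s Syn.⊛ a Syn.⊕ Syn.det c a s Syn.⊛ b Syn.⊕ Syn.det a b s Syn.⊛ c)))
      refl a₁ a₂ a₃ b₁ b₂ b₃ c₁ c₂ c₃ s₁ s₂ s₃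

unimodular-face-decomposition : ∀ d₁ d₂ c s → det d₁ d₂ c ≡ 1ℤ → det d₁ d₂ s ≡ 0ℤ →
  s ≡ (det d₂ c s ⊛ d₁) +ᵖ (det c d₁ s ⊛ d₂)
unimodular-face-decomposition d₁ d₂ c s unimodular on-face = begin
  s                                        ≡⟨ sym (⊛-identityˡ s) ⟩
  1ℤ ⊛ s                                   ≡⟨ cong (_⊛ s) (sym unimodular) ⟩
  det d₁ d₂ c ⊛ s                          ≡⟨ cramer d₁ d₂ c s ⟩
  in-face +ᵖ (det d₁ d₂ s ⊛ c)             ≡⟨ cong (λ t → in-face +ᵖ (t ⊛ c)) on-face ⟩
  in-face +ᵖ 0ᵖ                            ≡⟨ +ᵖ-identityʳ in-face ⟩
  in-face                                  ∎
  where
  open ≡-Reasoning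
  in-face : Point
  in-face = (det d₂ c s ⊛ d₁) +ᵖ (det c d₁ s ⊛ d₂)

Nonneg : List Point → Point → Set
Nonneg Fs p = All (λ f → 0ℤ ≤ f ∙ p) Fs

Nonneg? : ∀ Fs → Decidable (Nonneg Fs)
Nonneg? Fs p = All.all? (λ f → 0ℤ ℤ.≤? f ∙ p) Fs

Nonneg-0ᵖ : ∀ Fs → Nonneg Fs 0ᵖ
Nonneg-0ᵖ Fs = All.tabulate λ {f} _ → ℤP.≤-reflexive (sym (∙-zeroʳ f))

Nonneg-+ᵖ : ∀ {Fs p q} → Nonneg Fs p → Nonneg Fs q → Nonneg Fs (p +ᵖ q)
Nonneg-+ᵖ {p = p} {q} Fp Fq =
  All.zipWith (λ {f} (fp , fq) → subst (0ℤ ≤_) (sym (∙-+ᵖ f p q)) (ℤP.+-mono-≤ fp fq)) (Fp , Fq)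

NComb⇒Nonneg : ∀ {P Fs v} → (∀ {b} → P b → Nonneg Fs b) → NComb P v → Nonneg Fs v
NComb⇒Nonneg {Fs = Fs} P⇒ ncomb-zero          = Nonneg-0ᵖ Fs
NComb⇒Nonneg           P⇒ (ncomb-add Pb rest) = Nonneg-+ᵖ (P⇒ Pb) (NComb⇒Nonneg P⇒ rest)

summand-≤ : ∀ f {s t v} → 0ℤ ≤ f ∙ t → s +ᵖ t ≡ v → f ∙ s ≤ f ∙ v
summand-≤ f {s} {t} 0≤ft refl = begin
  f ∙ s         ≡⟨ ℤP.+-identityʳ (f ∙ s) ⟨
  f ∙ s + 0ℤ    ≤⟨ ℤP.+-monoʳ-≤ (f ∙ s) 0≤ft ⟩
  f ∙ s + f ∙ t ≡⟨ ∙-+ᵖ f s t ⟨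
  f ∙ (s +ᵖ t)  ∎
  where open ℤP.≤-Reasoning

nonneg-sum≡1 : ∀ {m n} → 0ℤ ≤ m → 0ℤ ≤ n → m + n ≡ 1ℤ → m ≡ 0ℤ ⊎ n ≡ 0ℤ
nonneg-sum≡1 {+ 0}                       _ _  _  = inj₁ refl
nonneg-sum≡1 {+ 1}           {+ 0}       _ _  _  = inj₂ refl
nonneg-sum≡1 {+ 1}           {+ suc n}   _ _  ()
nonneg-sum≡1 {+ suc (suc m)} {+ n}       _ _  ()
nonneg-sum≡1 {+ suc m}       { -[1+ n ]} _ () _
nonneg-sum≡1 { -[1+ m ]}                 () _ _

multiple-below⇒zero : ∀ α N → 0ℤ ≤ α * N → α * N < N → α ≡ 0ℤ
multiple-below⇒zero +0 N _ _ = refl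
multiple-below⇒zero +[1+ m ] N 0≤αN αN<N = contradiction (ℤP.≤-<-trans N≤αN αN<N) (ℤP.<-irrefl refl)
  where
  N≤αN : N ≤ +[1+ m ] * N
  N≤αN = subst (_≤ +[1+ m ] * N) (ℤP.*-identityˡ N)
    (ℤP.*-monoʳ-≤-nonNeg N {{ℤ.nonNegative (ℤP.<⇒≤ (ℤP.≤-<-trans 0≤αN αN<N))}}
      {1ℤ} {+[1+ m ]} (+≤+ (s≤s z≤n)))
multiple-below⇒zero -[1+ m ] N 0≤αN αN<N = contradiction 0≤α λ ()
  where
  0≤α : 0ℤ ≤ -[1+ m ]
  0≤α = ℤP.*-cancelʳ-≤-pos 0ℤ -[1+ m ] N {{ℤ.positive (ℤP.≤-<-trans 0≤αN αN<N)}} 0≤αN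

in-range : ∀ {x N m n} → x ≡ + m → N ≡ + n → m ℕ.< n → 0ℤ ≤ x × x < N
in-range refl refl m<n = +≤+ z≤n , +<+ m<n

-- Rational cones

integral : ℤ → ℚ
integral i = mkℚ i 0 (Coprimality.sym (Coprimality.1-coprimeTo _))

ℤ→ℚ-integral : ∀ i → ℤ→ℚ i ≡ integral i
ℤ→ℚ-integral i = ℚP.↥p/↧p≡p (integral i)

ℤ→ℚ-+ : ∀ m n → ℤ→ℚ (m + n) ≡ ℤ→ℚ m ℚ.+ ℤ→ℚ n
ℤ→ℚ-+ m n rewrite ℤ→ℚ-integral m | ℤ→ℚ-integral n =
  ℚP./-cong (sym (cong₂ _+_ (ℤP.*-identityʳ m) (ℤP.*-identityʳ n))) refl

ℤ→ℚ-* : ∀ m n → ℤ→ℚ (m * n) ≡ ℤ→ℚ m ℚ.* ℤ→ℚ n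
ℤ→ℚ-* m n rewrite ℤ→ℚ-integral m | ℤ→ℚ-integral n = refl

ℤ→ℚ-nonneg : ∀ {i} → 0ℤ ≤ i → 0ℚ ℚ.≤ ℤ→ℚ i
ℤ→ℚ-nonneg {i} 0≤i rewrite ℤ→ℚ-integral i = ℚ.*≤* (subst (0ℤ ≤_) (sym (ℤP.*-identityʳ i)) 0≤i)

ℤ→ℚ-nonneg⁻¹ : ∀ {i} → 0ℚ ℚ.≤ ℤ→ℚ i → 0ℤ ≤ i
ℤ→ℚ-nonneg⁻¹ {i} 0≤i rewrite ℤ→ℚ-integral i with 0≤i
... | ℚ.*≤* 0≤i*1 = subst (0ℤ ≤_) (ℤP.*-identityʳ i) 0≤i*1

infix 8 _∙ᵠ_
_∙ᵠ_ : Point → QPoint → ℚ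
(a , b , c) ∙ᵠ (x , y , z) = ℤ→ℚ a ℚ.* x ℚ.+ ℤ→ℚ b ℚ.* y ℚ.+ ℤ→ℚ c ℚ.* z

∙ᵠ-toQ : ∀ f p → f ∙ᵠ toQ p ≡ ℤ→ℚ (f ∙ p)
∙ᵠ-toQ (a , b , c) (x , y , z) = sym (begin
  ℤ→ℚ (a * x + b * y + c * z)
    ≡⟨ ℤ→ℚ-+ (a * x + b * y) (c * z) ⟩
  ℤ→ℚ (a * x + b * y) ℚ.+ ℤ→ℚ (c * z)
    ≡⟨ cong₂ ℚ._+_ (ℤ→ℚ-+ (a * x) (b * y)) (ℤ→ℚ-* c z) ⟩
  ℤ→ℚ (a * x) ℚ.+ ℤ→ℚ (b * y) ℚ.+ ℤ→ℚ c ℚ.* ℤ→ℚ z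
    ≡⟨ cong₂ (λ p q → p ℚ.+ q ℚ.+ ℤ→ℚ c ℚ.* ℤ→ℚ z) (ℤ→ℚ-* a x) (ℤ→ℚ-* b y) ⟩
  (a , b , c) ∙ᵠ toQ (x , y , z)
    ∎)
  where open ≡-Reasoning

module QSolver = ℚSolver.+-*-Solver

∙ᵠ-zeroʳ : ∀ f → f ∙ᵠ 0ᵠ ≡ 0ℚ
∙ᵠ-zeroʳ (a , b , c) = QSolver.solve 3
  (λ a b c → a :* con 0ℚ :+ b :* con 0ℚ :+ c :* con 0ℚ := con 0ℚ) refl (ℤ→ℚ a) (ℤ→ℚ b) (ℤ→ℚ c)
  where open QSolver using (_:=_; _:+_; _:*_; con)

∙ᵠ-cone-add : ∀ f t b q → f ∙ᵠ ((t ·ᵠ b) +ᵠ q) ≡ t ℚ.* f ∙ᵠ toQ b ℚ.+ f ∙ᵠ q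
∙ᵠ-cone-add (a , b , c) t (x , y , z) (q₁ , q₂ , q₃) = QSolver.solve 10
  (λ a b c t x y z q₁ q₂ q₃ →
     a :* (t :* x :+ q₁) :+ b :* (t :* y :+ q₂) :+ c :* (t :* z :+ q₃) :=
     t :* (a :* x :+ b :* y :+ c :* z) :+ (a :* q₁ :+ b :* q₂ :+ c :* q₃))
  refl (ℤ→ℚ a) (ℤ→ℚ b) (ℤ→ℚ c) t (ℤ→ℚ x) (ℤ→ℚ y) (ℤ→ℚ z) q₁ q₂ q₃
  where open QSolver using (_:=_; _:+_; _:*_)

ℚ-*-nonneg : ∀ {p q} → 0ℚ ℚ.≤ p → 0ℚ ℚ.≤ q → 0ℚ ℚ.≤ p ℚ.* q
ℚ-*-nonneg {p} {q} 0≤p 0≤q = ℚP.nonNegative⁻¹ _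
  {{ℚP.nonNeg*nonNeg⇒nonNeg p {{ℚ.nonNegative 0≤p}} q {{ℚ.nonNegative 0≤q}}}}

ConeComb-nonneg : ∀ {P q} f → (∀ {b} → P b → 0ℤ ≤ f ∙ b) → ConeComb P q → 0ℚ ℚ.≤ f ∙ᵠ q
ConeComb-nonneg f P⇒ cone-zero = ℚP.≤-reflexive (sym (∙ᵠ-zeroʳ f))
ConeComb-nonneg f P⇒ (cone-add {b} {q} t Pb 0≤t rest) =
  subst (0ℚ ℚ.≤_) (sym (∙ᵠ-cone-add f t b q))
    (ℚP.+-mono-≤ (ℚ-*-nonneg 0≤t (subst (0ℚ ℚ.≤_) (sym (∙ᵠ-toQ f b)) (ℤ→ℚ-nonneg (P⇒ Pb))))
                 (ConeComb-nonneg f P⇒ rest))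

InCone⇒Nonneg : ∀ {D Fs p} → All (Nonneg Fs) D → InCone D p → Nonneg Fs p
InCone⇒Nonneg {p = p} D⊆ p∈cone = All.tabulate λ {f} f∈Fs →
  ℤ→ℚ-nonneg⁻¹ (subst (0ℚ ℚ.≤_) (∙ᵠ-toQ f p)
    (ConeComb-nonneg f (λ d∈D → All.lookup (All.lookup D⊆ d∈D) f∈Fs) p∈cone))

InCone-self : ∀ {D d} → d ∈ D → InCone D d
InCone-self {D} {d} d∈D = subst (ConeComb (_∈ D)) (unit-combination d)
  (cone-add 1ℚ d∈D (ℚP.nonNegative⁻¹ 1ℚ) cone-zero)
  where
  unit-coordinate : ∀ x → 1ℚ ℚ.* x ℚ.+ 0ℚ ≡ x
  unit-coordinate x = trans (ℚP.+-identityʳ _) (ℚP.*-identityˡ x)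
  unit-combination : ∀ p → (1ℚ ·ᵠ p) +ᵠ 0ᵠ ≡ toQ p
  unit-combination (x , y , z) =
    cong₂ _,_ (unit-coordinate _) (cong₂ _,_ (unit-coordinate _) (unit-coordinate _))

InCone-combination : ∀ {D d₁ d₂ d₃ v N a₁ a₂ a₃} → d₁ ∈ D → d₂ ∈ D → d₃ ∈ D →
  0ℤ < N → 0ℤ ≤ a₁ → 0ℤ ≤ a₂ → 0ℤ ≤ a₃ →
  N ⊛ v ≡ ((a₁ ⊛ d₁) +ᵖ (a₂ ⊛ d₂)) +ᵖ (a₃ ⊛ d₃) → InCone D v
InCone-combination {N = +0}       _ _ _ (+<+ ()) _ _ _ _
InCone-combination {D} {d₁} {d₂} {d₃} {v} {+[1+ n ]} {a₁} {a₂} {a₃}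
                   d₁∈D d₂∈D d₃∈D _ 0≤a₁ 0≤a₂ 0≤a₃ scaled =
  subst (ConeComb (_∈ D)) combination≡v
    (cone-add (coefficient a₁) d₁∈D (coefficient-nonneg 0≤a₁)
    (cone-add (coefficient a₂) d₂∈D (coefficient-nonneg 0≤a₂)
    (cone-add (coefficient a₃) d₃∈D (coefficient-nonneg 0≤a₃) cone-zero)))
  where
  N : ℤ
  N = +[1+ n ]

  r : ℚ
  r = 1/ integral N

  coefficient : ℤ → ℚ
  coefficient a = ℤ→ℚ a ℚ.* r

  coefficient-nonneg : ∀ {a} → 0ℤ ≤ a → 0ℚ ℚ.≤ coefficient a
  coefficient-nonneg 0≤a = ℚ-*-nonneg (ℤ→ℚ-nonneg 0≤a) (ℚP.nonNegative⁻¹ r)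

  r*N≡1 : r ℚ.* ℤ→ℚ N ≡ 1ℚ
  r*N≡1 = trans (cong (r ℚ.*_) (ℤ→ℚ-integral N)) (ℚP.*-inverseˡ (integral N))

  coordinate : ∀ {x₁ x₂ x₃ w} → N * w ≡ a₁ * x₁ + a₂ * x₂ + a₃ * x₃ →
    coefficient a₁ ℚ.* ℤ→ℚ x₁ ℚ.+ (coefficient a₂ ℚ.* ℤ→ℚ x₂ ℚ.+ (coefficient a₃ ℚ.* ℤ→ℚ x₃ ℚ.+ 0ℚ)) ≡ ℤ→ℚ w
  coordinate {x₁} {x₂} {x₃} {w} Nw≡ = begin
    coefficient a₁ ℚ.* ℤ→ℚ x₁ ℚ.+ (coefficient a₂ ℚ.* ℤ→ℚ x₂ ℚ.+ (coefficient a₃ ℚ.* ℤ→ℚ x₃ ℚ.+ 0ℚ))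
      ≡⟨ solve 7 (λ r a₁ a₂ a₃ x₁ x₂ x₃ →
           a₁ :* r :* x₁ :+ (a₂ :* r :* x₂ :+ (a₃ :* r :* x₃ :+ con 0ℚ)) :=
           r :* (a₁ :* x₁ :+ a₂ :* x₂ :+ a₃ :* x₃))
           refl r (ℤ→ℚ a₁) (ℤ→ℚ a₂) (ℤ→ℚ a₃) (ℤ→ℚ x₁) (ℤ→ℚ x₂) (ℤ→ℚ x₃) ⟩
    r ℚ.* ((a₁ , a₂ , a₃) ∙ᵠ toQ (x₁ , x₂ , x₃)) ≡⟨ cong (r ℚ.*_) (∙ᵠ-toQ (a₁ , a₂ , a₃) (x₁ , x₂ , x₃)) ⟩
    r ℚ.* ℤ→ℚ (a₁ * x₁ + a₂ * x₂ + a₃ * x₃)       ≡⟨ cong (λ z → r ℚ.* ℤ→ℚ z) Nw≡ ⟨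
    r ℚ.* ℤ→ℚ (N * w)                              ≡⟨ cong (r ℚ.*_) (ℤ→ℚ-* N w) ⟩
    r ℚ.* (ℤ→ℚ N ℚ.* ℤ→ℚ w)                        ≡⟨ ℚP.*-assoc r (ℤ→ℚ N) (ℤ→ℚ w) ⟨
    r ℚ.* ℤ→ℚ N ℚ.* ℤ→ℚ w                          ≡⟨ cong (ℚ._* ℤ→ℚ w) r*N≡1 ⟩
    1ℚ ℚ.* ℤ→ℚ w                                   ≡⟨ ℚP.*-identityˡ (ℤ→ℚ w) ⟩
    ℤ→ℚ w                                          ∎
    where
    open ≡-Reasoning
    open QSolver using (solve; _:=_; _:+_; _:*_; con)

  combination≡v :
    (coefficient a₁ ·ᵠ d₁) +ᵠ ((coefficient a₂ ·ᵠ d₂) +ᵠ ((coefficient a₃ ·ᵠ d₃) +ᵠ 0ᵠ)) ≡ toQ v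
  combination≡v = cong₂ _,_ (coordinate (cong proj₁ scaled))
    (cong₂ _,_ (coordinate (cong (λ p → proj₁ (proj₂ p)) scaled))
               (coordinate (cong (λ p → proj₂ (proj₂ p)) scaled)))

-- Irreducible points

Irreducible : (Point → Set) → Point → Set
Irreducible M v = v ≢ 0ᵖ × (∀ {s t} → M s → M t → s +ᵖ t ≡ v → s ≡ 0ᵖ ⊎ t ≡ 0ᵖ)

irreducible-generator : ∀ {P Fs v} → (∀ {b} → P b → Nonneg Fs b) → Irreducible (Nonneg Fs) v →
  NComb P v → P v
irreducible-generator {P} {v = v} P⇒ (v≢0ᵖ , indecomposable) = go refl
  where
  go : ∀ {u} → u ≡ v → NComb P u → P v
  go u≡v ncomb-zero = contradiction (sym u≡v) v≢0ᵖ
  go u≡v (ncomb-add {b} {w} Pb w∈) with indecomposable (P⇒ Pb) (NComb⇒Nonneg P⇒ w∈) u≡v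
  ... | inj₁ refl = go (trans (sym (+ᵖ-identityˡ w)) u≡v) w∈
  ... | inj₂ refl = subst P (trans (sym (+ᵖ-identityʳ b)) u≡v) Pb

module Simplex (d₁ d₂ d₃ : Point) where

  Δ : ℤ
  Δ = det d₁ d₂ d₃

  vertices facets : List Point
  vertices = d₁ ∷ d₂ ∷ d₃ ∷ []
  facets   = d₂ ⨯ d₃ ∷ d₃ ⨯ d₁ ∷ d₁ ⨯ d₂ ∷ []

  facets-nonneg-on-vertices : 0ℤ ≤ Δ → All (Nonneg facets) vertices
  facets-nonneg-on-vertices 0≤Δ =
      (equals-Δ (det-cycle d₁ d₂ d₃) ∷ vanishes (det-repeat₂₃ d₃ d₁) ∷ vanishes (det-repeat₁₃ d₁ d₂) ∷ [])
    ∷ (vanishes (det-repeat₁₃ d₂ d₃) ∷ equals-Δ (trans (det-cycle d₁ d₂ d₃) (det-cycle d₂ d₃ d₁))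
                                     ∷ vanishes (det-repeat₂₃ d₁ d₂) ∷ [])
    ∷ (vanishes (det-repeat₂₃ d₂ d₃) ∷ vanishes (det-repeat₁₃ d₃ d₁) ∷ 0≤Δ ∷ [])
    ∷ []
    where
    vanishes : ∀ {x} → x ≡ 0ℤ → 0ℤ ≤ x
    vanishes x≡0 = ℤP.≤-reflexive (sym x≡0)
    equals-Δ : ∀ {x} → Δ ≡ x → 0ℤ ≤ x
    equals-Δ Δ≡x = subst (0ℤ ≤_) Δ≡x 0≤Δ

  InCone-vertices : ∀ {v} → 0ℤ < Δ → 0ℤ ≤ det d₂ d₃ v → 0ℤ ≤ det d₃ d₁ v → 0ℤ ≤ det d₁ d₂ v →
    InCone vertices v
  InCone-vertices {v} 0<Δ 0≤a₁ 0≤a₂ 0≤a₃ =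
    InCone-combination (here refl) (there (here refl)) (there (there (here refl)))
      0<Δ 0≤a₁ 0≤a₂ 0≤a₃ (cramer d₁ d₂ d₃ v)

  facet₁-on-face : ∀ α β → det d₂ d₃ ((α ⊛ d₁) +ᵖ (β ⊛ d₂)) ≡ α * Δ
  facet₁-on-face α β = begin
    det d₂ d₃ ((α ⊛ d₁) +ᵖ (β ⊛ d₂))        ≡⟨ ∙-combination (d₂ ⨯ d₃) α d₁ β d₂ ⟩
    α * det d₂ d₃ d₁ + β * det d₂ d₃ d₂     ≡⟨ cong₂ (λ x y → α * x + β * y) Δ≡ (det-repeat₁₃ d₂ d₃) ⟩
    α * Δ + β * 0ℤ                          ≡⟨ cong (λ x → α * Δ + x) (ℤP.*-zeroʳ β) ⟩
    α * Δ + 0ℤ                              ≡⟨ ℤP.+-identityʳ (α * Δ) ⟩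
    α * Δ                                   ∎
    where
    open ≡-Reasoning
    Δ≡ : det d₂ d₃ d₁ ≡ Δ
    Δ≡ = sym (det-cycle d₁ d₂ d₃)

  facet₂-on-face : ∀ α β → det d₃ d₁ ((α ⊛ d₁) +ᵖ (β ⊛ d₂)) ≡ β * Δ
  facet₂-on-face α β = begin
    det d₃ d₁ ((α ⊛ d₁) +ᵖ (β ⊛ d₂))        ≡⟨ ∙-combination (d₃ ⨯ d₁) α d₁ β d₂ ⟩
    α * det d₃ d₁ d₁ + β * det d₃ d₁ d₂     ≡⟨ cong₂ (λ x y → α * x + β * y) (det-repeat₂₃ d₃ d₁) (sym Δ≡) ⟩
    α * 0ℤ + β * Δ                          ≡⟨ cong (_+ (β * Δ)) (ℤP.*-zeroʳ α) ⟩
    0ℤ + β * Δ                              ≡⟨ ℤP.+-identityˡ (β * Δ) ⟩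
    β * Δ                                   ∎
    where
    open ≡-Reasoning
    Δ≡ : Δ ≡ det d₃ d₁ d₂
    Δ≡ = trans (det-cycle d₁ d₂ d₃) (det-cycle d₂ d₃ d₁)

  irreducible : ∀ {c v} → det d₁ d₂ c ≡ 1ℤ → det d₁ d₂ v ≡ 1ℤ →
    det d₂ d₃ v < Δ → det d₃ d₁ v < Δ → Irreducible (Nonneg facets) v
  irreducible {c} {v} unimodular height a₁<Δ a₂<Δ = v≢0ᵖ , indecomposable
    where
    v≢0ᵖ : v ≢ 0ᵖ
    v≢0ᵖ refl = contradiction (trans (sym (∙-zeroʳ (d₁ ⨯ d₂))) height) λ ()

    -- Cramer's rule for the lattice basis d₁, d₂, c writes s = α d₁ + β d₂ with α, β integers;
    -- the facet values α Δ and β Δ of s are bounded by those of v, hence lie in [0, Δ), so α = β = 0.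
    on-face⇒0ᵖ : ∀ {s t} → Nonneg facets s → Nonneg facets t → s +ᵖ t ≡ v → det d₁ d₂ s ≡ 0ℤ → s ≡ 0ᵖ
    on-face⇒0ᵖ {s} {t} (0≤a₁s ∷ 0≤a₂s ∷ _) (0≤a₁t ∷ 0≤a₂t ∷ _) s+t≡v on-face =
      trans decomposition (cong₂ (λ α β → (α ⊛ d₁) +ᵖ (β ⊛ d₂)) α≡0 β≡0)
      where
      α β : ℤ
      α = det d₂ c s
      β = det c d₁ s
      decomposition : s ≡ (α ⊛ d₁) +ᵖ (β ⊛ d₂)
      decomposition = unimodular-face-decomposition d₁ d₂ c s unimodular on-face
      a₁s≡ : det d₂ d₃ s ≡ α * Δ
      a₁s≡ = trans (cong (det d₂ d₃) decomposition) (facet₁-on-face α β)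
      a₂s≡ : det d₃ d₁ s ≡ β * Δ
      a₂s≡ = trans (cong (det d₃ d₁) decomposition) (facet₂-on-face α β)
      α≡0 : α ≡ 0ℤ
      α≡0 = multiple-below⇒zero α Δ (subst (0ℤ ≤_) a₁s≡ 0≤a₁s)
        (subst (_< Δ) a₁s≡ (ℤP.≤-<-trans (summand-≤ (d₂ ⨯ d₃) 0≤a₁t s+t≡v) a₁<Δ))
      β≡0 : β ≡ 0ℤ
      β≡0 = multiple-below⇒zero β Δ (subst (0ℤ ≤_) a₂s≡ 0≤a₂s)
        (subst (_< Δ) a₂s≡ (ℤP.≤-<-trans (summand-≤ (d₃ ⨯ d₁) 0≤a₂t s+t≡v) a₂<Δ))

    indecomposable : ∀ {s t} → Nonneg facets s → Nonneg facets t → s +ᵖ t ≡ v → s ≡ 0ᵖ ⊎ t ≡ 0ᵖ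
    indecomposable {s} {t} s∈@(_ ∷ _ ∷ 0≤a₃s ∷ []) t∈@(_ ∷ _ ∷ 0≤a₃t ∷ []) s+t≡v
      with nonneg-sum≡1 0≤a₃s 0≤a₃t
             (trans (sym (∙-+ᵖ (d₁ ⨯ d₂) s t)) (trans (cong (det d₁ d₂) s+t≡v) height))
    ... | inj₁ s-on-face = inj₁ (on-face⇒0ᵖ s∈ t∈ s+t≡v s-on-face)
    ... | inj₂ t-on-face = inj₂ (on-face⇒0ᵖ t∈ s∈ (trans (+ᵖ-comm t s) s+t≡v) t-on-face)

  unimodular-vertex-irreducible : Δ ≡ 1ℤ → Irreducible (Nonneg facets) d₃
  unimodular-vertex-irreducible Δ≡1 =
    irreducible Δ≡1 Δ≡1 (below-one (det-repeat₂₃ d₂ d₃)) (below-one (det-repeat₁₃ d₃ d₁))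
    where
    below-one : ∀ {x} → x ≡ 0ℤ → x < Δ
    below-one x≡0 = subst₂ _<_ (sym x≡0) (sym Δ≡1) (+<+ (s≤s z≤n))

-- The cone C

C-rays : List Point
C-rays = P₀ ∷ P₁ ∷ P₂ ∷ P₃ ∷ []

module Rays {B : List Point} (B⊆C : ∀ b → b ∈ B → InC b)
            (generates : ∀ v → InC v → NComb (_∈ B) v) where

  unimodular-ray∈B : ∀ d₁ d₂ {p} → p ∈ C-rays → det d₁ d₂ p ≡ 1ℤ →
    {True (All.all? (Nonneg? (Simplex.facets d₁ d₂ p)) C-rays)} → p ∈ B
  unimodular-ray∈B d₁ d₂ {p} p∈C unimodular {C⊆S} =
    irreducible-generator (λ {b} b∈B → InCone⇒Nonneg (toWitness C⊆S) (B⊆C b b∈B))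
      (Simplex.unimodular-vertex-irreducible d₁ d₂ p unimodular)
      (generates p (InCone-self p∈C))

  P₀∈B : P₀ ∈ B
  P₀∈B = unimodular-ray∈B (+ 1 , -[1+ 0 ] , -[1+ 0 ]) P₂ (here refl) refl

  P₁∈B : P₁ ∈ B
  P₁∈B = unimodular-ray∈B P₃ (-[1+ 0 ] , + 1 , + 0) (there (here refl)) refl

  P₂∈B : P₂ ∈ B
  P₂∈B = unimodular-ray∈B P₀ (+ 1 , -[1+ 0 ] , -[1+ 0 ]) (there (there (here refl))) refl

  P₃∈B : P₃ ∈ B
  P₃∈B = unimodular-ray∈B (-[1+ 0 ] , + 1 , + 0) P₁ (there (there (there (here refl)))) refl

module Lifts {B : List Point} (supernormal : Supernormal B) where
  open +-*-Solver using (solve; _:=_; _:+_; con)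

  simplex-point∈B : ∀ {d₁ d₂ d₃} c v → All (_∈ B) (Simplex.vertices d₁ d₂ d₃) →
    det d₁ d₂ c ≡ 1ℤ → det d₁ d₂ v ≡ 1ℤ →
    0ℤ ≤ det d₂ d₃ v × det d₂ d₃ v < det d₁ d₂ d₃ →
    0ℤ ≤ det d₃ d₁ v × det d₃ d₁ v < det d₁ d₂ d₃ → v ∈ B
  simplex-point∈B {d₁} {d₂} {d₃} c v vertices⊆B unimodular height (0≤a₁ , a₁<Δ) (0≤a₂ , a₂<Δ) =
    proj₁ (irreducible-generator (λ (_ , b∈cone) → InCone⇒Nonneg facets-nonneg b∈cone)
                                 (irreducible unimodular height a₁<Δ a₂<Δ)
                                 (supernormal vertices (All.lookup vertices⊆B) v v∈cone))
    where
    open Simplex d₁ d₂ d₃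
    0<Δ : 0ℤ < Δ
    0<Δ = ℤP.≤-<-trans 0≤a₁ a₁<Δ
    facets-nonneg : All (Nonneg facets) vertices
    facets-nonneg = facets-nonneg-on-vertices (ℤP.<⇒≤ 0<Δ)
    v∈cone : InCone vertices v
    v∈cone = InCone-vertices 0<Δ 0≤a₁ 0≤a₂ (subst (0ℤ ≤_) (sym height) (+≤+ z≤n))

  -e₃ : Point
  -e₃ = (+ 0 , + 0 , -[1+ 0 ])

  P₃-lift⇒P₂-lift : ∀ k → P₀ ∈ B → P₂ ∈ B → P₃ ↑ + k ∈ B → P₂ ↑ + suc k ∈ B
  P₃-lift⇒P₂-lift k P₀∈B P₂∈B w∈B =
    simplex-point∈B -e₃ (P₂ ↑ + suc k) (P₀∈B ∷ w∈B ∷ P₂∈B ∷ [])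
      (unimodular (+ k)) (height (+ k))
      (in-range (a₁ (+ k)) (Δ (+ k)) (ℕP.n<1+n (suc k)))
      (in-range (a₂ (+ k)) (Δ (+ k)) (ℕP.n<1+n (suc k)))
    where
    Δ : ∀ K → det P₀ (P₃ ↑ K) P₂ ≡ + 2 + K
    Δ = solve 1 (λ K → Syn.det ⌜ P₀ ⌝ (⌜ P₃ ⌝ Syn.↑ K) ⌜ P₂ ⌝ := con (+ 2) :+ K) refl
    a₁ : ∀ K → det (P₃ ↑ K) P₂ (P₂ ↑ (+ 1 + K)) ≡ + 1 + K
    a₁ = solve 1
      (λ K → Syn.det (⌜ P₃ ⌝ Syn.↑ K) ⌜ P₂ ⌝ (⌜ P₂ ⌝ Syn.↑ (con (+ 1) :+ K)) := con (+ 1) :+ K) refl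
    a₂ : ∀ K → det P₂ P₀ (P₂ ↑ (+ 1 + K)) ≡ + 1 + K
    a₂ = solve 1 (λ K → Syn.det ⌜ P₂ ⌝ ⌜ P₀ ⌝ (⌜ P₂ ⌝ Syn.↑ (con (+ 1) :+ K)) := con (+ 1) :+ K) refl
    height : ∀ K → det P₀ (P₃ ↑ K) (P₂ ↑ (+ 1 + K)) ≡ 1ℤ
    height = solve 1
      (λ K → Syn.det ⌜ P₀ ⌝ (⌜ P₃ ⌝ Syn.↑ K) (⌜ P₂ ⌝ Syn.↑ (con (+ 1) :+ K)) := con 1ℤ) refl
    unimodular : ∀ K → det P₀ (P₃ ↑ K) -e₃ ≡ 1ℤ
    unimodular = solve 1 (λ K → Syn.det ⌜ P₀ ⌝ (⌜ P₃ ⌝ Syn.↑ K) ⌜ -e₃ ⌝ := con 1ℤ) refl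

  P₂-lift⇒P₃-lift : ∀ k → P₁ ∈ B → P₃ ∈ B → P₂ ↑ + k ∈ B → P₃ ↑ + k ∈ B
  P₂-lift⇒P₃-lift k P₁∈B P₃∈B w∈B =
    simplex-point∈B -e₃ (P₃ ↑ + k) (w∈B ∷ P₁∈B ∷ P₃∈B ∷ [])
      (unimodular (+ k)) (height (+ k))
      (in-range (a₁ (+ k)) (Δ (+ k)) (ℕP.n<1+n k))
      (in-range (a₂ (+ k)) (Δ (+ k)) (ℕP.n<1+n k))
    where
    Δ : ∀ K → det (P₂ ↑ K) P₁ P₃ ≡ + 1 + K
    Δ = solve 1 (λ K → Syn.det (⌜ P₂ ⌝ Syn.↑ K) ⌜ P₁ ⌝ ⌜ P₃ ⌝ := con (+ 1) :+ K) refl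
    a₁ : ∀ K → det P₁ P₃ (P₃ ↑ K) ≡ K
    a₁ = solve 1 (λ K → Syn.det ⌜ P₁ ⌝ ⌜ P₃ ⌝ (⌜ P₃ ⌝ Syn.↑ K) := K) refl
    a₂ : ∀ K → det P₃ (P₂ ↑ K) (P₃ ↑ K) ≡ K
    a₂ = solve 1 (λ K → Syn.det ⌜ P₃ ⌝ (⌜ P₂ ⌝ Syn.↑ K) (⌜ P₃ ⌝ Syn.↑ K) := K) refl
    height : ∀ K → det (P₂ ↑ K) P₁ (P₃ ↑ K) ≡ 1ℤ
    height = solve 1 (λ K → Syn.det (⌜ P₂ ⌝ Syn.↑ K) ⌜ P₁ ⌝ (⌜ P₃ ⌝ Syn.↑ K) := con 1ℤ) refl
    unimodular : ∀ K → det (P₂ ↑ K) P₁ -e₃ ≡ 1ℤ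
    unimodular = solve 1 (λ K → Syn.det (⌜ P₂ ⌝ Syn.↑ K) ⌜ P₁ ⌝ ⌜ -e₃ ⌝ := con 1ℤ) refl

P₃-lifts : ℕ ↣ Point
P₃-lifts = mk↣ {to = λ k → P₃ ↑ + k} λ eq → ℤP.+-injective (cong (λ p → proj₂ (proj₂ p)) eq)

theorem2p3 : (B : List Point) → (∀ b → b ∈ B → InC b) →
    (∀ v → InC v → NComb (_∈ B) v) → ¬ Supernormal B
theorem2p3 B B⊆C generates supernormal = finite P₃-lifts B P₃-lift∈B
  where
  open Rays B⊆C generates
  open Lifts supernormal
  P₃-lift∈B : ∀ k → P₃ ↑ + k ∈ B
  P₃-lift∈B zero    = P₃∈B
  P₃-lift∈B (suc k) = P₂-lift⇒P₃-lift (suc k) P₁∈B P₃∈B (P₃-lift⇒P₂-lift k P₀∈B P₂∈B (P₃-lift∈B k))
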